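{- $F_u$ is $2$-thin for any $u\in L_{\mathrm{up}}$; that is, for every $v\in V$ there are at most two links $\ell\in F_u$ with $v\in V_\ell$.
   Context: Let $G=(V,E)$ be a tree with links $L\subseteq\binom{V}{2}$, and fix a root $r\in V$. For a link $\ell$, $P_\ell$ is the edge set of the path in $G$ between its endpoints and $V_\ell$ its vertex set (including endpoints). $z$ is an ancestor of $v$ if $z$ lies on the $r$-$v$ path (including $r,v$); descendant is the converse. $\mathrm{apex}(\ell)$ is the vertex of $V_\ell$ closest to $r$. An up-link is a link $\{t,b\}$ with $t$ an ancestor of $b$; $L_{\mathrm{up}}$ is the set of up-links. Let $F\subseteq L$ satisfy $\bigcup_{\ell\in F}P_\ell=E$. For $v\in V$ let $B_v=\{\ell\in F\colon \mathrm{apex}(\ell)\text{ is a descendant of }v\}$. For $u=\{t,b\}\in L_{\mathrm{up}}$ with $t$ an ancestor of $b$, let $v_u$ be the ancestor of $t$ farthest from $r$ with $P_u\subseteq\bigcup_{\ell\in B_{v_u}}P_\ell$, and let $F_u\subseteq B_{v_u}$ be a fixed inclusion-wise minimal set with $P_u\subseteq\bigcup_{\ell\in F_u}P_\ell$. -}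

module Defs where

open import Data.Nat using (ℕ; zero; suc; _≤_; _<_)
open import Data.Fin using (Fin; toℕ)
open import Data.Bool using (Bool; true; false)
open import Data.Product using (Σ; ∃; _×_; _,_)
open import Data.Sum using (_⊎_)
open import Relation.Binary.PropositionalEquality using (_≡_; _≢_)
open import Relation.Nullary using (¬_)
open import Data.Empty using (⊥)

iter : ∀ {n} → (Fin n → Fin n) → ℕ → Fin n → Fin n
iter p zero v = v
iter p (suc k) v = p (iter p k v)

-- A tree on the vertex set V = Fin n, rooted at r, given by parent pointers.
-- Its edge set is E = { {c , parent c} : c ≢ root }; every vertex reaches the
-- root, so the graph is a tree (connected, n - 1 edges, acyclic).
record RootedTree (n : ℕ) : Set where
  field
    root         : Fin n
    parent       : Fin n → Fin n
    parent-root  : parent root ≡ root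
    reaches-root : ∀ v → ∃ λ k → iter parent k v ≡ root

-- A link {a , b} with a ≠ b, stored in normal form a < b.
record Link (n : ℕ) : Set where
  constructor link
  field
    end₁ : Fin n
    end₂ : Fin n
    ordered : toℕ end₁ < toℕ end₂
open Link public

SameLink : ∀ {n} → Link n → Link n → Set
SameLink ℓ ℓ' = (end₁ ℓ ≡ end₁ ℓ') × (end₂ ℓ ≡ end₂ ℓ')

-- Finite (decidable) sets of links: membership of {a , b} (a < b) is S a b ≡ true.
LinkSet : ℕ → Set
LinkSet n = Fin n → Fin n → Bool

_∈ˡ_ : ∀ {n} → Link n → LinkSet n → Set
ℓ ∈ˡ S = S (end₁ ℓ) (end₂ ℓ) ≡ true

_⊆ˡ_ : ∀ {n} → LinkSet n → LinkSet n → Set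
S ⊆ˡ S' = ∀ ℓ → ℓ ∈ˡ S → ℓ ∈ˡ S'

_⊂ˡ_ : ∀ {n} → LinkSet n → LinkSet n → Set
S ⊂ˡ S' = (S ⊆ˡ S') × (∃ λ ℓ → ℓ ∈ˡ S' × ¬ (ℓ ∈ˡ S))

module _ {n : ℕ} (T : RootedTree n) where
  open RootedTree T

  -- z is an ancestor of v (z lies on the r-v path, including r and v)
  Anc : Fin n → Fin n → Set
  Anc z v = ∃ λ k → iter parent k v ≡ z

  Depth : Fin n → ℕ → Set
  Depth v k = (iter parent k v ≡ root) × (∀ j → j < k → iter parent j v ≢ root)

  -- The edge {c , parent c} (c ≢ root) lies on the tree path between a and b
  -- iff c's subtree contains exactly one of a, b.
  EdgeOnPath : Fin n → Fin n → Fin n → Set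
  EdgeOnPath a b c = (Anc c a × ¬ Anc c b) ⊎ (¬ Anc c a × Anc c b)

  -- edge (given by its child vertex c) is in P_ℓ
  InP : Link n → Fin n → Set
  InP ℓ c = EdgeOnPath (end₁ ℓ) (end₂ ℓ) c

  -- w ∈ V_ℓ: w is an endpoint of some edge of P_ℓ (P_ℓ ≠ ∅ as endpoints differ)
  InV : Link n → Fin n → Set
  InV ℓ w = ∃ λ c → (c ≢ root) × InP ℓ c × ((w ≡ c) ⊎ (w ≡ parent c))

  IsApex : Link n → Fin n → Set
  IsApex ℓ w = InV ℓ w ×
    (∀ x dw dx → InV ℓ x → Depth w dw → Depth x dx → dw ≤ dx)

  InB : LinkSet n → Fin n → Link n → Set
  InB F v ℓ = (ℓ ∈ˡ F) × (∃ λ w → IsApex ℓ w × Anc v w)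

  Covers : (Link n → Set) → (Fin n → Set) → Set
  Covers S P = ∀ c → c ≢ root → P c → ∃ λ ℓ → S ℓ × InP ℓ c

  AllEdges : Fin n → Set
  AllEdges c = c ≢ root

  UpLink : Link n → Fin n → Fin n → Set
  UpLink u t b =
    (((end₁ u ≡ t) × (end₂ u ≡ b)) ⊎ ((end₁ u ≡ b) × (end₂ u ≡ t))) × Anc t b

  IsVu : LinkSet n → Link n → Fin n → Fin n → Set
  IsVu F u t vu =
    Anc vu t × Covers (InB F vu) (InP u) ×
    (∀ z dz dvu → Anc z t → Covers (InB F z) (InP u) →
       Depth z dz → Depth vu dvu → dz ≤ dvu)

  IsFu : LinkSet n → Link n → Fin n → LinkSet n → Set
  IsFu F u vu Fu =
    (∀ ℓ → ℓ ∈ˡ Fu → InB F vu ℓ) ×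
    Covers (λ ℓ → ℓ ∈ˡ Fu) (InP u) ×
    (∀ S → S ⊂ˡ Fu → ¬ Covers (λ ℓ → ℓ ∈ˡ S) (InP u))

  TwoThin : LinkSet n → Set
  TwoThin S = ∀ v ℓ₁ ℓ₂ ℓ₃ →
    ℓ₁ ∈ˡ S → ℓ₂ ∈ˡ S → ℓ₃ ∈ˡ S →
    InV ℓ₁ v → InV ℓ₂ v → InV ℓ₃ v →
    ¬ SameLink ℓ₁ ℓ₂ → ¬ SameLink ℓ₁ ℓ₃ → ¬ SameLink ℓ₂ ℓ₃ → ⊥

{-# OPTIONS --safe #-}
module Submission where

open import Defs
open import Data.Nat using (ℕ; zero; suc; _+_; _∸_; _≤_; _≤?_; s≤s)
open import Data.Nat.Properties using (m∸n+n≡m; ≰⇒>; <⇒≤)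
open import Data.Fin using (Fin; toℕ; fromℕ; fromℕ<; _≟_)
open import Data.Fin.Properties using (any?; toℕ-fromℕ; toℕ-fromℕ<)
open import Data.Bool using (false; if_then_else_)
open import Data.Product using (∃; _×_; _,_)
open import Data.Sum using (_⊎_; inj₁; inj₂; [_,_]′; swap)
import Data.Sum as Sum
open import Data.Empty using (⊥; ⊥-elim)
open import Relation.Nullary using (¬_; Dec; yes; no)
open import Relation.Nullary.Decidable using (_×-dec_; _⊎-dec_; ¬?; ⌊_⌋; map′; decidable-stable)
open import Relation.Unary using (Decidable; _∩_; _⊆_)
open import Relation.Unary.Properties using (_∩?_; ∁?)
open import Relation.Binary.PropositionalEquality using (_≡_; refl; sym; trans; cong; subst₂; module ≡-Reasoning)
open ≡-Reasoning

-- Fix v and the links of F_u through v. The edges of the vertical path P_u are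
-- totally ordered; split them into those on the root path of v and the others.
-- For a link ℓ through v, P_ℓ meets each part in a segment starting where the
-- root path of v leaves P_u, so on each part the traces of two links through v
-- are nested. Among three links through v, one is then dominated on both parts
-- by the other two, so dropping it from F_u still covers P_u, contradicting
-- minimality.

AtLeastTwo : Set → Set → Set → Set
AtLeastTwo A B C = (A × B) ⊎ (A × C) ⊎ (B × C)

atLeastTwo-meet : ∀ {A B C A′ B′ C′ : Set} →
  AtLeastTwo A B C → AtLeastTwo A′ B′ C′ → (A × A′) ⊎ (B × B′) ⊎ (C × C′)
atLeastTwo-meet (inj₁ (a , _))         (inj₁ (a′ , _))         = inj₁ (a , a′)
atLeastTwo-meet (inj₁ (a , _))         (inj₂ (inj₁ (a′ , _)))  = inj₁ (a , a′)
atLeastTwo-meet (inj₁ (_ , b))         (inj₂ (inj₂ (b′ , _)))  = inj₂ (inj₁ (b , b′))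
atLeastTwo-meet (inj₂ (inj₁ (a , _)))  (inj₁ (a′ , _))         = inj₁ (a , a′)
atLeastTwo-meet (inj₂ (inj₁ (a , _)))  (inj₂ (inj₁ (a′ , _)))  = inj₁ (a , a′)
atLeastTwo-meet (inj₂ (inj₁ (_ , c)))  (inj₂ (inj₂ (_ , c′)))  = inj₂ (inj₂ (c , c′))
atLeastTwo-meet (inj₂ (inj₂ (b , _)))  (inj₁ (_ , b′))         = inj₂ (inj₁ (b , b′))
atLeastTwo-meet (inj₂ (inj₂ (_ , c)))  (inj₂ (inj₁ (_ , c′)))  = inj₂ (inj₂ (c , c′))
atLeastTwo-meet (inj₂ (inj₂ (b , _)))  (inj₂ (inj₂ (b′ , _)))  = inj₂ (inj₁ (b , b′))

module _ {X : Set} (R : X → X → Set) where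

  atLeastTwo-belowAnother : ∀ {x y z} → R x y ⊎ R y x → R x z ⊎ R z x → R y z ⊎ R z y →
    AtLeastTwo (R x y ⊎ R x z) (R y x ⊎ R y z) (R z x ⊎ R z y)
  atLeastTwo-belowAnother (inj₁ xy) _         (inj₁ yz) = inj₁ (inj₁ xy , inj₂ yz)
  atLeastTwo-belowAnother (inj₁ xy) _         (inj₂ zy) = inj₂ (inj₁ (inj₁ xy , inj₂ zy))
  atLeastTwo-belowAnother (inj₂ yx) (inj₁ xz) _         = inj₁ (inj₂ xz , inj₁ yx)
  atLeastTwo-belowAnother (inj₂ yx) (inj₂ zx) _         = inj₂ (inj₂ (inj₁ yx , inj₁ zx))

module _ {X : Set} (R S : X → X → Set) where

  BelowOthers : X → X → X → Set
  BelowOthers i j k = (R i j ⊎ R i k) × (S i j ⊎ S i k)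

  belowOthers-among-three : ∀ {x y z} →
    R x y ⊎ R y x → R x z ⊎ R z x → R y z ⊎ R z y →
    S x y ⊎ S y x → S x z ⊎ S z x → S y z ⊎ S z y →
    BelowOthers x y z ⊎ BelowOthers y x z ⊎ BelowOthers z x y
  belowOthers-among-three rxy rxz ryz sxy sxz syz =
    atLeastTwo-meet (atLeastTwo-belowAnother R rxy rxz ryz) (atLeastTwo-belowAnother S sxy sxz syz)

DownClosedIn : ∀ {n} → (Fin n → Set) → (Fin n → Fin n → Set) → (Fin n → Set) → Set
DownClosedIn D _≼_ P = ∀ {c d} → D c → D d → d ≼ c → P c → P d

downsets-nested : ∀ {n} {D P Q : Fin n → Set} (_≼_ : Fin n → Fin n → Set) →
  Decidable D → Decidable P → Decidable Q →
  (∀ {c d} → D c → D d → c ≼ d ⊎ d ≼ c) →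
  DownClosedIn D _≼_ P → DownClosedIn D _≼_ Q →
  (D ∩ P ⊆ Q) ⊎ (D ∩ Q ⊆ P)
downsets-nested _≼_ D? P? Q? total P↓ Q↓ with any? ((D? ∩? P?) ∩? ∁? Q?)
... | no ∄ = inj₁ λ {c} (dc , pc) → decidable-stable (Q? c) (λ ¬qc → ∄ (c , (dc , pc) , ¬qc))
... | yes (c , (dc , pc) , ¬qc) = inj₂ λ (dd , qd) →
  [ (λ c≼d → ⊥-elim (¬qc (Q↓ dd dc c≼d qd))) , (λ d≼c → P↓ dc dd d≼c pc) ]′ (total dc dd)

sameLink? : ∀ {n} (ℓ ℓ′ : Link n) → Dec (SameLink ℓ ℓ′)
sameLink? ℓ ℓ′ = (end₁ ℓ ≟ end₁ ℓ′) ×-dec (end₂ ℓ ≟ end₂ ℓ′)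

_∖ˡ_ : ∀ {n} → LinkSet n → Link n → LinkSet n
(S ∖ˡ ℓ) a b = if ⌊ (a ≟ end₁ ℓ) ×-dec (b ≟ end₂ ℓ) ⌋ then false else S a b

module _ {n} {S : LinkSet n} {ℓ : Link n} where

  ∖ˡ-⊆ : (S ∖ˡ ℓ) ⊆ˡ S
  ∖ˡ-⊆ ℓ′ with sameLink? ℓ′ ℓ
  ... | yes _ = λ ()
  ... | no _  = λ ℓ′∈S → ℓ′∈S

  ∉-∖ˡ : ¬ (ℓ ∈ˡ (S ∖ˡ ℓ))
  ∉-∖ˡ with sameLink? ℓ ℓ
  ... | yes _  = λ ()
  ... | no ℓ≉ℓ = ⊥-elim (ℓ≉ℓ (refl , refl))

  ∈-∖ˡ : ∀ {ℓ′} → ℓ′ ∈ˡ S → ¬ SameLink ℓ′ ℓ → ℓ′ ∈ˡ (S ∖ˡ ℓ)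
  ∈-∖ˡ {ℓ′} ℓ′∈S ℓ′≉ℓ with sameLink? ℓ′ ℓ
  ... | yes ℓ′≈ℓ = ⊥-elim (ℓ′≉ℓ ℓ′≈ℓ)
  ... | no _     = ℓ′∈S

  ∖ˡ-⊂ : ℓ ∈ˡ S → (S ∖ˡ ℓ) ⊂ˡ S
  ∖ˡ-⊂ ℓ∈S = ∖ˡ-⊆ , ℓ , ℓ∈S , ∉-∖ˡ

¬SameLink-sym : ∀ {n} {ℓ ℓ′ : Link n} → ¬ SameLink ℓ ℓ′ → ¬ SameLink ℓ′ ℓ
¬SameLink-sym ℓ≉ℓ′ (e₁ , e₂) = ℓ≉ℓ′ (sym e₁ , sym e₂)

module _ {n : ℕ} (T : RootedTree n) where
  open RootedTree T

  iter-+ : ∀ j k v → iter parent (j + k) v ≡ iter parent j (iter parent k v)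
  iter-+ zero    k v = refl
  iter-+ (suc j) k v = cong parent (iter-+ j k v)

  iter-suc : ∀ k v → iter parent (suc k) v ≡ iter parent k (parent v)
  iter-suc zero    v = refl
  iter-suc (suc k) v = cong parent (iter-suc k v)

  iter-root : ∀ k → iter parent k root ≡ root
  iter-root zero    = refl
  iter-root (suc k) = trans (cong parent (iter-root k)) parent-root

  Anc-trans : ∀ {x y z} → Anc T x y → Anc T y z → Anc T x z
  Anc-trans {z = z} (j , yʲ≡x) (k , zᵏ≡y) =
    j + k , trans (iter-+ j k z) (trans (cong (iter parent j) zᵏ≡y) yʲ≡x)

  Anc-parent : ∀ {x y} → Anc T x y → Anc T (parent x) y
  Anc-parent (k , e) = suc k , cong parent e

  Anc-step : ∀ {x y} → Anc T x y → x ≡ y ⊎ Anc T x (parent y)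
  Anc-step (zero  , e) = inj₁ (sym e)
  Anc-step {y = y} (suc k , e) = inj₂ (k , trans (sym (iter-suc k y)) e)

  iter-comparable : ∀ j k v →
    Anc T (iter parent j v) (iter parent k v) ⊎ Anc T (iter parent k v) (iter parent j v)
  iter-comparable zero    k       v = inj₂ (k , refl)
  iter-comparable (suc j) zero    v = inj₁ (suc j , refl)
  iter-comparable (suc j) (suc k) v rewrite iter-suc j v | iter-suc k v =
    iter-comparable j k (parent v)

  Anc-comparable : ∀ {x y z} → Anc T x z → Anc T y z → Anc T x y ⊎ Anc T y x
  Anc-comparable {z = z} (j , refl) (k , refl) = iter-comparable j k z

  iter-beyond : ∀ {m k v} → iter parent m v ≡ root → m ≤ k → iter parent k v ≡ root
  iter-beyond {m} {k} {v} vᵐ≡r m≤k = begin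
    iter parent k v                        ≡⟨ cong (λ i → iter parent i v) (m∸n+n≡m m≤k) ⟨
    iter parent (k ∸ m + m) v              ≡⟨ iter-+ (k ∸ m) m v ⟩
    iter parent (k ∸ m) (iter parent m v)  ≡⟨ cong (iter parent (k ∸ m)) vᵐ≡r ⟩
    iter parent (k ∸ m) root               ≡⟨ iter-root (k ∸ m) ⟩
    root                                   ∎

  Anc-bounded : ∀ {z v m} → iter parent m v ≡ root → Anc T z v →
    ∃ λ (k : Fin (suc m)) → iter parent (toℕ k) v ≡ z
  Anc-bounded {z} {v} {m} vᵐ≡r (k , vᵏ≡z) with k ≤? m
  ... | yes k≤m =
    fromℕ< (s≤s k≤m) , trans (cong (λ i → iter parent i v) (toℕ-fromℕ< (s≤s k≤m))) vᵏ≡z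
  ... | no k≰m = fromℕ m , (begin
    iter parent (toℕ (fromℕ m)) v  ≡⟨ cong (λ i → iter parent i v) (toℕ-fromℕ m) ⟩
    iter parent m v                ≡⟨ vᵐ≡r ⟩
    root                           ≡⟨ iter-beyond vᵐ≡r (<⇒≤ (≰⇒> k≰m)) ⟨
    iter parent k v                ≡⟨ vᵏ≡z ⟩
    z                              ∎)

  anc? : ∀ z v → Dec (Anc T z v)
  anc? z v with reaches-root v
  ... | m , vᵐ≡r = map′ (λ (k , e) → toℕ k , e) (Anc-bounded {m = m} vᵐ≡r)
                        (any? (λ k → iter parent (toℕ k) v ≟ z))

  inP? : ∀ ℓ → Decidable (InP T ℓ)
  inP? ℓ c = (anc? c (end₁ ℓ) ×-dec ¬? (anc? c (end₂ ℓ)))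
       ⊎-dec (¬? (anc? c (end₁ ℓ)) ×-dec anc? c (end₂ ℓ))

  SameLink-InP : ∀ {ℓ ℓ′ c} → SameLink ℓ ℓ′ → InP T ℓ c → InP T ℓ′ c
  SameLink-InP {c = c} (e₁ , e₂) = subst₂ (λ a b → EdgeOnPath T a b c) e₁ e₂

  InP-uplink⇒Anc-bottom : ∀ {u t b c} → UpLink T u t b → InP T u c → Anc T c b
  InP-uplink⇒Anc-bottom (inj₁ (refl , refl) , tb) (inj₁ (ct , _)) = Anc-trans ct tb
  InP-uplink⇒Anc-bottom (inj₁ (refl , refl) , tb) (inj₂ (_ , cb)) = cb
  InP-uplink⇒Anc-bottom (inj₂ (refl , refl) , tb) (inj₁ (cb , _)) = cb
  InP-uplink⇒Anc-bottom (inj₂ (refl , refl) , tb) (inj₂ (_ , ct)) = Anc-trans ct tb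

  separating-edge-below-common-ancestor : ∀ {c d y y′} →
    Anc T c y → ¬ Anc T c y′ → Anc T d y → Anc T d y′ → Anc T d (parent c)
  separating-edge-below-common-ancestor cy ¬cy′ dy dy′ with Anc-comparable cy dy
  ... | inj₁ cd = ⊥-elim (¬cy′ (Anc-trans cd dy′))
  ... | inj₂ dc with Anc-step dc
  ...   | inj₁ refl = ⊥-elim (¬cy′ dy′)
  ...   | inj₂ d-pc = d-pc

  Anc-from-edge-end : ∀ {c v y} → v ≡ c ⊎ v ≡ parent c → Anc T c y → Anc T v y
  Anc-from-edge-end (inj₁ refl) cy = cy
  Anc-from-edge-end (inj₂ refl) cy = Anc-parent cy

  Anc-to-edge-end : ∀ {c v d} → Anc T d (parent c) → v ≡ c ⊎ v ≡ parent c → Anc T d v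
  Anc-to-edge-end d-pc (inj₁ refl) = Anc-trans d-pc (1 , refl)
  Anc-to-edge-end d-pc (inj₂ refl) = d-pc

  InV⇒Anc-end : ∀ {ℓ v} → InV T ℓ v → Anc T v (end₁ ℓ) ⊎ Anc T v (end₂ ℓ)
  InV⇒Anc-end (_ , _ , inj₁ (ca , _) , v∈c) = inj₁ (Anc-from-edge-end v∈c ca)
  InV⇒Anc-end (_ , _ , inj₂ (_ , cb) , v∈c) = inj₂ (Anc-from-edge-end v∈c cb)

  InV-below-common-ancestor : ∀ {ℓ v d} →
    InV T ℓ v → Anc T d (end₁ ℓ) → Anc T d (end₂ ℓ) → Anc T d v
  InV-below-common-ancestor (_ , _ , inj₁ (ca , ¬cb) , v∈c) da db =
    Anc-to-edge-end (separating-edge-below-common-ancestor ca ¬cb da db) v∈c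
  InV-below-common-ancestor (_ , _ , inj₂ (¬ca , cb) , v∈c) da db =
    Anc-to-edge-end (separating-edge-below-common-ancestor cb ¬ca db da) v∈c

  InP-descendant-on-rootpath : ∀ {ℓ v d e} →
    InV T ℓ v → Anc T d v → Anc T e d → InP T ℓ e → InP T ℓ d
  InP-descendant-on-rootpath {ℓ} ℓ∋v dv ed (inj₁ (ea , ¬eb)) with InV⇒Anc-end {ℓ} ℓ∋v
  ... | inj₁ va = inj₁ (Anc-trans dv va , λ db → ¬eb (Anc-trans ed db))
  ... | inj₂ vb = ⊥-elim (¬eb (Anc-trans ed (Anc-trans dv vb)))
  InP-descendant-on-rootpath {ℓ} ℓ∋v dv ed (inj₂ (¬ea , eb)) with InV⇒Anc-end {ℓ} ℓ∋v
  ... | inj₁ va = ⊥-elim (¬ea (Anc-trans ed (Anc-trans dv va)))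
  ... | inj₂ vb = inj₂ ((λ da → ¬ea (Anc-trans ed da)) , Anc-trans dv vb)

  InP-ancestor-off-rootpath : ∀ {ℓ v d e} →
    InV T ℓ v → ¬ Anc T d v → Anc T d e → InP T ℓ e → InP T ℓ d
  InP-ancestor-off-rootpath {ℓ} ℓ∋v ¬dv de (inj₁ (ea , _)) =
    inj₁ (Anc-trans de ea , λ db → ¬dv (InV-below-common-ancestor {ℓ} ℓ∋v (Anc-trans de ea) db))
  InP-ancestor-off-rootpath {ℓ} ℓ∋v ¬dv de (inj₂ (_ , eb)) =
    inj₂ ((λ da → ¬dv (InV-below-common-ancestor {ℓ} ℓ∋v da (Anc-trans de eb))) , Anc-trans de eb)

  minimal-cover-irredundant : ∀ {Fu : LinkSet n} {P : Fin n → Set} {i : Link n} →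
    Covers T (_∈ˡ Fu) P → (∀ S → S ⊂ˡ Fu → ¬ Covers T (_∈ˡ S) P) → i ∈ˡ Fu →
    (∀ c → P c → InP T i c → ∃ λ ℓ → (ℓ ∈ˡ Fu × ¬ SameLink ℓ i) × InP T ℓ c) → ⊥
  minimal-cover-irredundant {Fu} {P} {i} cover minimal i∈Fu covered-without-i =
    minimal (Fu ∖ˡ i) (∖ˡ-⊂ {S = Fu} {i} i∈Fu) cover′
    where
    cover′ : Covers T (_∈ˡ (Fu ∖ˡ i)) P
    cover′ c c≢r pc with cover c c≢r pc
    ... | ℓ , ℓ∈Fu , ℓc with sameLink? ℓ i
    ...   | no ℓ≉i = ℓ , ∈-∖ˡ {S = Fu} {i} {ℓ} ℓ∈Fu ℓ≉i , ℓc
    ...   | yes ℓ≈i with covered-without-i c pc (SameLink-InP {ℓ} {i} ℓ≈i ℓc)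
    ...     | ℓ′ , (ℓ′∈Fu , ℓ′≉i) , ℓ′c = ℓ′ , ∈-∖ˡ {S = Fu} {i} {ℓ′} ℓ′∈Fu ℓ′≉i , ℓ′c

  module TracesThrough (u : Link n) (t b : Fin n) (u-up : UpLink T u t b) (v : Fin n) where

    OnRootpath OffRootpath : Fin n → Set
    OnRootpath c = InP T u c × Anc T c v
    OffRootpath c = InP T u c × ¬ Anc T c v

    _⊑↑_ _⊑↓_ : Link n → Link n → Set
    i ⊑↑ j = OnRootpath ∩ InP T i ⊆ InP T j
    i ⊑↓ j = OffRootpath ∩ InP T i ⊆ InP T j

    Pᵤ-comparable : ∀ {c d} → InP T u c → InP T u d → Anc T c d ⊎ Anc T d c
    Pᵤ-comparable uc ud =
      Anc-comparable (InP-uplink⇒Anc-bottom {u} u-up uc) (InP-uplink⇒Anc-bottom {u} u-up ud)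

    ⊑↑-total : ∀ i j → InV T i v → InV T j v → i ⊑↑ j ⊎ j ⊑↑ i
    ⊑↑-total i j i∋v j∋v =
      downsets-nested (λ d c → Anc T c d) (inP? u ∩? (λ c → anc? c v)) (inP? i) (inP? j)
        (λ (uc , _) (ud , _) → swap (Pᵤ-comparable uc ud))
        (λ _ (_ , dv) → InP-descendant-on-rootpath {i} i∋v dv)
        (λ _ (_ , dv) → InP-descendant-on-rootpath {j} j∋v dv)

    ⊑↓-total : ∀ i j → InV T i v → InV T j v → i ⊑↓ j ⊎ j ⊑↓ i
    ⊑↓-total i j i∋v j∋v =
      downsets-nested (Anc T) (inP? u ∩? ∁? (λ c → anc? c v)) (inP? i) (inP? j)
        (λ (uc , _) (ud , _) → Pᵤ-comparable uc ud)
        (λ _ (_ , ¬dv) → InP-ancestor-off-rootpath {i} i∋v ¬dv)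
        (λ _ (_ , ¬dv) → InP-ancestor-off-rootpath {j} j∋v ¬dv)

    covered-by-others : ∀ {i j k} → BelowOthers _⊑↑_ _⊑↓_ i j k →
      ∀ c → InP T u c → InP T i c → InP T j c ⊎ InP T k c
    covered-by-others (on , off) c uc ic with anc? c v
    ... | yes cv = Sum.map (λ i⊑j → i⊑j ((uc , cv) , ic)) (λ i⊑k → i⊑k ((uc , cv) , ic)) on
    ... | no ¬cv = Sum.map (λ i⊑j → i⊑j ((uc , ¬cv) , ic)) (λ i⊑k → i⊑k ((uc , ¬cv) , ic)) off

    module MinimalCover {Fu : LinkSet n} (cover : Covers T (_∈ˡ Fu) (InP T u))
             (minimal : ∀ S → S ⊂ˡ Fu → ¬ Covers T (_∈ˡ S) (InP T u)) where

      ¬belowOthers : ∀ i j k → i ∈ˡ Fu → j ∈ˡ Fu → k ∈ˡ Fu →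
        ¬ SameLink j i → ¬ SameLink k i → ¬ BelowOthers _⊑↑_ _⊑↓_ i j k
      ¬belowOthers i j k i∈Fu j∈Fu k∈Fu j≉i k≉i below =
        minimal-cover-irredundant {i = i} cover minimal i∈Fu λ c uc ic →
          [ (λ jc → j , (j∈Fu , j≉i) , jc) , (λ kc → k , (k∈Fu , k≉i) , kc) ]′
            (covered-by-others {i} {j} {k} below c uc ic)

lemma10 : (n : ℕ) (T : RootedTree n) (L F : LinkSet n) →
    F ⊆ˡ L → Covers T (λ ℓ → ℓ ∈ˡ F) (AllEdges T) →
    (u : Link n) (t b : Fin n) → u ∈ˡ L → UpLink T u t b →
    (vu : Fin n) → IsVu T F u t vu →
    (Fu : LinkSet n) → IsFu T F u vu Fu →
    TwoThin T Fu
lemma10 _ T _ _ _ _ u t b _ u-up _ _ Fu (_ , cover , minimal)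
  v ℓ₁ ℓ₂ ℓ₃ ℓ₁∈ ℓ₂∈ ℓ₃∈ ℓ₁∋v ℓ₂∋v ℓ₃∋v ℓ₁≉ℓ₂ ℓ₁≉ℓ₃ ℓ₂≉ℓ₃ =
  [ ¬belowOthers ℓ₁ ℓ₂ ℓ₃ ℓ₁∈ ℓ₂∈ ℓ₃∈
      (¬SameLink-sym {ℓ = ℓ₁} {ℓ₂} ℓ₁≉ℓ₂) (¬SameLink-sym {ℓ = ℓ₁} {ℓ₃} ℓ₁≉ℓ₃)
  , [ ¬belowOthers ℓ₂ ℓ₁ ℓ₃ ℓ₂∈ ℓ₁∈ ℓ₃∈ ℓ₁≉ℓ₂ (¬SameLink-sym {ℓ = ℓ₂} {ℓ₃} ℓ₂≉ℓ₃)
    , ¬belowOthers ℓ₃ ℓ₁ ℓ₂ ℓ₃∈ ℓ₁∈ ℓ₂∈ ℓ₁≉ℓ₃ ℓ₂≉ℓ₃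
    ]′
  ]′
  (belowOthers-among-three _⊑↑_ _⊑↓_ {ℓ₁} {ℓ₂} {ℓ₃}
    (⊑↑-total ℓ₁ ℓ₂ ℓ₁∋v ℓ₂∋v) (⊑↑-total ℓ₁ ℓ₃ ℓ₁∋v ℓ₃∋v) (⊑↑-total ℓ₂ ℓ₃ ℓ₂∋v ℓ₃∋v)
    (⊑↓-total ℓ₁ ℓ₂ ℓ₁∋v ℓ₂∋v) (⊑↓-total ℓ₁ ℓ₃ ℓ₁∋v ℓ₃∋v) (⊑↓-total ℓ₂ ℓ₃ ℓ₂∋v ℓ₃∋v))
  where
  open TracesThrough T u t b u-up v
  open MinimalCover cover minimal
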